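{- Let $P$ be a dynamic path (as in the context) with $n\ge1$, $w_0>0$ and $w_n>0$. Let $t=\max\{i:\ \Theta_L(P,x_i)<\Theta_R(P,x_i)\}$ and set $$\Theta^+_L(P,x_t)=\Theta_L(P,x_{t+1})-\tau(x_{t+1}-x_t),\qquad \Theta^-_R(P,x_{t+1})=\Theta_R(P,x_t)-\tau(x_{t+1}-x_t)$$ (these equal $\lim_{x\downarrow x_t}\Theta_L(P,x)$ and $\lim_{x\uparrow x_{t+1}}\Theta_R(P,x)$ respectively). Then $\Theta^1(P)=\Theta(P,x^*)$, where $$x^*=\begin{cases}x_t & \text{if }\Theta^+_L(P,x_t)\ge\Theta_R(P,x_t),\\[2pt] \dfrac{\Theta_R(P,x_t)-\Theta_L(P,x_{t+1})+\tau(x_t+x_{t+1})}{2\tau} & \text{if }\Theta^+_L(P,x_t)<\Theta_R(P,x_t)\text{ and }\Theta_L(P,x_{t+1})>\Theta^-_R(P,x_{t+1}),\\[2pt] x_{t+1} & \text{if }\Theta_L(P,x_{t+1})\le\Theta^-_R(P,x_{t+1}).\end{cases}$$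
   Context: A dynamic path $P$ consists of real points (vertices) $x_0<\dots<x_n$, edges $e_i=(x_{i-1},x_i)$, a constant $\tau>0$ (time to travel unit distance) with every $|x_i-x_j|\tau$ an integer, nonnegative integer weights $w_i$ (people at $x_i$) and positive integer capacities $c_i$ of $e_i$. Discrete evacuation model with sink $x\in[x_0,x_n]$ (any point): everyone moves toward $x$; time is discrete; at each vertex people wait in a FIFO queue to enter the next edge toward $x$; at each integer time step at most $c_i$ people may enter $e_i$, entering as soon as capacity and the queue permit; distance $d$ takes time $d\tau$; people starting at $x$ are evacuated at time $0$. $\Theta_L(P,x)$ (resp. $\Theta_R(P,x)$) is the time at which all people starting on vertices strictly left (resp. right) of $x$ have reached $x$; $\Theta(P,x)=\max(\Theta_L(P,x),\Theta_R(P,x))$ and $\Theta^1(P)=\min_{x\in[x_0,x_n]}\Theta(P,x)$.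
   Formalization: Sinks x range only over the points of $[x_0,x_n]$ whose time-distance τ(x−x_0) from x_0 is rational, rather than over all real points, both for x* and in the minimum defining Θ¹(P). -}

module Defs where

open import Data.Nat as ℕ using (ℕ; zero; suc; _+_; _∸_; _⊓_)
open import Data.Nat.Properties using (_≟_)
open import Data.Maybe using (Maybe; just; nothing)
open import Data.List using (List; []; _∷_; _++_; replicate)
open import Data.Integer using (+_)
open import Data.Rational as ℚ using (ℚ; _/_; 0ℚ)
open import Data.Rational.Properties as ℚP using ()
open import Data.Product using (_×_)
open import Relation.Nullary using (yes; no; ¬_)

-- A dynamic path, in normalised "time units": pos i = τ·x_i (a natural number,
-- after translating the line so that all τ·x_i are nonnegative integers).
-- Only indices 0..n are meaningful (pos, w); capacities c i for edges e_i, i = 1..n.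
record DynPath : Set where
  field
    n   : ℕ
    pos : ℕ → ℕ
    w   : ℕ → ℕ
    c   : ℕ → ℕ      -- capacity of e_i = (x_{i-1}, x_i)
open DynPath public

record Valid (P : DynPath) : Set where
  field
    incr : ∀ i → suc i ℕ.≤ n P → pos P i ℕ.< pos P (suc i)
    cap  : ∀ i → 1 ℕ.≤ i → i ℕ.≤ n P → 1 ℕ.≤ c P i
open Valid public

-- Discrete FIFO queue with capacity.
-- A flow is a list of counts indexed by integer time 0,1,2,...

-- empty a queue of q people, at most k per step (fuel q suffices when k ≥ 1)
drain : (fuel k q : ℕ) → List ℕ
drain zero    k q = []
drain (suc f) k q with q ≟ 0
... | yes _ = []
... | no  _ = (q ⊓ k) ∷ drain f k (q ∸ k)

-- given the current queue q and arrivals per time step, the numbers of people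
-- entering the next edge per time step (arrivals at time t may enter at time t)
process : (k q : ℕ) → List ℕ → List ℕ
process k q []       = drain q k q
process k q (a ∷ as) = (q + a) ⊓ k ∷ process k ((q + a) ∸ ((q + a) ⊓ k)) as

-- add the people initially at a vertex (present at time 0)
addHead : ℕ → List ℕ → List ℕ
addHead m []       = m ∷ []
addHead m (a ∷ as) = (m + a) ∷ as

-- leftward-to-rightward evacuation: arrivals at vertex j (incl. initial people)
arrivals : DynPath → ℕ → List ℕ
departures : DynPath → ℕ → List ℕ
arrivals P zero    = w P 0 ∷ []
arrivals P (suc j) = addHead (w P (suc j))
                       (replicate (pos P (suc j) ∸ pos P j) 0 ++ departures P j)
-- people entering edge e_{j+1} (from x_j towards x_{j+1}) per time step
departures P j = process (c P (suc j)) 0 (arrivals P j)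

lastNZ : List ℕ → Maybe ℕ
lastNZ []       = nothing
lastNZ (a ∷ as) with lastNZ as
... | just i  = just (suc i)
... | nothing with a ≟ 0
...   | yes _ = nothing
...   | no  _ = just 0

ℕtoℚ : ℕ → ℚ
ℕtoℚ m = + m / 1

lastBelow : DynPath → ℚ → ℕ → Maybe ℕ
lastBelow P s zero with ℕtoℚ (pos P 0) ℚP.<? s
... | yes _ = just 0
... | no  _ = nothing
lastBelow P s (suc j) with ℕtoℚ (pos P (suc j)) ℚP.<? s
... | yes _ = just (suc j)
... | no  _ = lastBelow P s j

-- Θ_L(P, s): time (in the τ-scaled units, i.e. actual time) at which everyone
-- starting strictly left of the sink s (given as τ·x) has reached s.
ΘL : DynPath → ℚ → ℚ
ΘL P s with lastBelow P s (n P)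
... | nothing = 0ℚ
... | just k with lastNZ (departures P k)
...   | nothing = 0ℚ
...   | just T  = ℕtoℚ T ℚ.+ (s ℚ.- ℕtoℚ (pos P k))

reversePath : DynPath → DynPath
reversePath P = record
  { n   = n P
  ; pos = λ i → pos P (n P) ∸ pos P (n P ∸ i)
  ; w   = λ i → w P (n P ∸ i)
  ; c   = λ i → c P (suc (n P) ∸ i)
  }

-- Θ_R(P, s): evacuation time of everyone strictly right of s
ΘR : DynPath → ℚ → ℚ
ΘR P s = ΘL (reversePath P) (ℕtoℚ (pos P (n P)) ℚ.- s)

Θ : DynPath → ℚ → ℚ
Θ P s = ΘL P s ℚ.⊔ ΘR P s

InPath : DynPath → ℚ → Set
InPath P s = (ℕtoℚ (pos P 0) ℚ.≤ s) × (s ℚ.≤ ℕtoℚ (pos P (n P)))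

-- Θ¹(P) = Θ(P, s), i.e. s is an optimal 1-sink
IsOptimalSink : DynPath → ℚ → Set
IsOptimalSink P s = InPath P s × (∀ s' → InPath P s' → Θ P s ℚ.≤ Θ P s')

X : DynPath → ℕ → ℚ
X P i = ℕtoℚ (pos P i)

-- Let T_k be the last time step at which someone enters the edge e_{k+1}. For a
-- sink s in (x_k, x_{k+1}] the last evacuee from the left arrives at T_k + τ(s − x_k),
-- so Θ_L has slope 1 on each edge. As w_0 > 0, people pass through every vertex,
-- and T_{k+1} ≥ T_k + τ(x_{k+1} − x_k) because a FIFO queue with positive capacity
-- never empties before its input stops; hence Θ_L is nondecreasing. Mirroring the
-- path (using w_n > 0), Θ_R has slope −1 on each edge, is nonincreasing, and
-- Θ_R(x_n) = 0 forces t < n. Maximality of t gives Θ_L < Θ_R at x_t and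
-- Θ_R ≤ Θ_L at x_{t+1}, so max(Θ_L, Θ_R) is minimised on [x_t, x_{t+1}], where it
-- is the maximum of two lines of slopes ±1: the minimum sits at x_t, at x_{t+1},
-- or at their crossing point x*.
module Submission where

open import Defs
open import Data.Nat as ℕ using (ℕ; zero; suc; z≤n; s≤s; _∸_; _⊓_)
import Data.Nat.Properties as ℕP
open import Data.Nat.Coprimality using (1-coprimeTo) renaming (sym to coprime-sym)
open import Data.Integer as ℤ using (+_)
import Data.Integer.Properties as ℤP
open import Data.Rational using (ℚ; mkℚ; _+_; _-_; _*_; -_; ½; 0ℚ; _⊔_; _≤_; _<_; *≤*; *<*)
import Data.Rational.Properties as ℚP
import Data.Rational.Unnormalised as ℚᵘ
import Data.Rational.Unnormalised.Properties as ℚᵘP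
open import Data.Rational.Solver using (module +-*-Solver)
open import Data.Maybe using (Maybe; just; nothing; fromMaybe)
open import Data.Maybe.Relation.Unary.Any as Any using (Any; just)
open import Data.List using ([]; _∷_; _++_; replicate)
open import Data.Product using (_×_; _,_)
open import Data.Sum using (inj₁; inj₂)
open import Data.Empty using (⊥-elim)
open import Relation.Nullary using (yes; no; ¬_)
open import Relation.Binary.PropositionalEquality

open +-*-Solver

ℕtoℚ≡mkℚ : ∀ m → ℕtoℚ m ≡ mkℚ (+ m) 0 (coprime-sym (1-coprimeTo m))
ℕtoℚ≡mkℚ m = ℚP.normalize-coprime (coprime-sym (1-coprimeTo m))

ℕtoℚ-+ : ∀ m k → ℕtoℚ (m ℕ.+ k) ≡ ℕtoℚ m + ℕtoℚ k
ℕtoℚ-+ m k rewrite ℕtoℚ≡mkℚ m | ℕtoℚ≡mkℚ k | ℕtoℚ≡mkℚ (m ℕ.+ k) =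
  ℚP.toℚᵘ-injective (ℚᵘP.≃-trans (ℚᵘ.*≡* cross-product) (ℚᵘP.≃-sym (ℚP.toℚᵘ-homo-+ m/1 k/1)))
  where
  m/1 k/1 : ℚ
  m/1 = mkℚ (+ m) 0 (coprime-sym (1-coprimeTo m))
  k/1 = mkℚ (+ k) 0 (coprime-sym (1-coprimeTo k))
  cross-product : + (m ℕ.+ k) ℤ.* + 1 ≡ (+ m ℤ.* + 1 ℤ.+ + k ℤ.* + 1) ℤ.* + 1
  cross-product rewrite ℤP.*-identityʳ (+ (m ℕ.+ k)) | ℤP.*-identityʳ (+ m)
                      | ℤP.*-identityʳ (+ k) | ℤP.*-identityʳ (+ m ℤ.+ + k) = ℤP.pos-+ m k

ℕtoℚ-∸ : ∀ {m k} → k ℕ.≤ m → ℕtoℚ (m ∸ k) ≡ ℕtoℚ m - ℕtoℚ k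
ℕtoℚ-∸ {m} {k} k≤m = begin
  ℕtoℚ (m ∸ k)                        ≡⟨ solve 2 (λ x y → y := (x :+ y) :- x) refl (ℕtoℚ k) (ℕtoℚ (m ∸ k)) ⟩
  (ℕtoℚ k + ℕtoℚ (m ∸ k)) - ℕtoℚ k    ≡⟨ cong (_- ℕtoℚ k) (sym (ℕtoℚ-+ k (m ∸ k))) ⟩
  ℕtoℚ (k ℕ.+ (m ∸ k)) - ℕtoℚ k       ≡⟨ cong (λ x → ℕtoℚ x - ℕtoℚ k) (ℕP.m+[n∸m]≡n k≤m) ⟩
  ℕtoℚ m - ℕtoℚ k                     ∎
  where open ≡-Reasoning

ℕtoℚ-mono-≤ : ∀ {m k} → m ℕ.≤ k → ℕtoℚ m ≤ ℕtoℚ k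
ℕtoℚ-mono-≤ {m} {k} m≤k rewrite ℕtoℚ≡mkℚ m | ℕtoℚ≡mkℚ k =
  *≤* (subst₂ ℤ._≤_ (sym (ℤP.*-identityʳ (+ m))) (sym (ℤP.*-identityʳ (+ k))) (ℤ.+≤+ m≤k))

ℕtoℚ-mono-< : ∀ {m k} → m ℕ.< k → ℕtoℚ m < ℕtoℚ k
ℕtoℚ-mono-< {m} {k} m<k rewrite ℕtoℚ≡mkℚ m | ℕtoℚ≡mkℚ k =
  *<* (subst₂ ℤ._<_ (sym (ℤP.*-identityʳ (+ m))) (sym (ℤP.*-identityʳ (+ k))) (ℤ.+<+ m<k))

0≤ℕtoℚ : ∀ m → 0ℚ ≤ ℕtoℚ m
0≤ℕtoℚ m = ℕtoℚ-mono-≤ (z≤n {m})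

<⇒≱ : ∀ {p q} → p < q → ¬ q ≤ p
<⇒≱ p<q q≤p = ℚP.<-irrefl refl (ℚP.<-≤-trans p<q q≤p)

p≤p+q : ∀ {p q} → 0ℚ ≤ q → p ≤ p + q
p≤p+q {p} {q} 0≤q = subst (_≤ p + q) (ℚP.+-identityʳ p) (ℚP.+-monoʳ-≤ p 0≤q)

p<p+q : ∀ {p q} → 0ℚ < q → p < p + q
p<p+q {p} {q} 0<q = subst (_< p + q) (ℚP.+-identityʳ p) (ℚP.+-monoʳ-< p 0<q)

p-q≤p : ∀ {p q} → 0ℚ ≤ q → p - q ≤ p
p-q≤p {p} {q} 0≤q = subst (p - q ≤_) (ℚP.+-identityʳ p) (ℚP.+-monoʳ-≤ p (ℚP.neg-antimono-≤ 0≤q))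

p≤q⇒0≤q-p : ∀ {p q} → p ≤ q → 0ℚ ≤ q - p
p≤q⇒0≤q-p {p} {q} p≤q = subst (_≤ q - p) (ℚP.+-inverseʳ p) (ℚP.+-monoˡ-≤ (- p) p≤q)

p<q⇒0<q-p : ∀ {p q} → p < q → 0ℚ < q - p
p<q⇒0<q-p {p} {q} p<q = subst (_< q - p) (ℚP.+-inverseʳ p) (ℚP.+-monoˡ-< (- p) p<q)

r-q≤r-p : ∀ r {p q} → p ≤ q → r - q ≤ r - p
r-q≤r-p r p≤q = ℚP.+-monoʳ-≤ r (ℚP.neg-antimono-≤ p≤q)

r-q<r-p : ∀ r {p q} → p < q → r - q < r - p
r-q<r-p r p<q = ℚP.+-monoʳ-< r (ℚP.neg-antimono-< p<q)

½[p+q]≤p⊔q : ∀ p q → ½ * (p + q) ≤ p ⊔ q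
½[p+q]≤p⊔q p q = subst (½ * (p + q) ≤_) (solve 1 (λ m → con ½ :* (m :+ m) := m) refl (p ⊔ q))
  (ℚP.*-monoˡ-≤-nonNeg ½ (ℚP.+-mono-≤ (ℚP.p≤p⊔q p q) (ℚP.p≤q⊔p p q)))

module Envelope (L R : ℚ → ℚ) {lo a b hi : ℚ} (lo≤a : lo ≤ a) (a<b : a < b) (b≤hi : b ≤ hi)
  (L-slope : ∀ {s} → a < s → s ≤ b → L b ≡ L s + (b - s))
  (L-mono : ∀ {s} → b ≤ s → s ≤ hi → L b ≤ L s)
  (R-slope : ∀ {s} → a ≤ s → s < b → R a ≡ R s + (s - a))
  (R-antimono : ∀ {s} → lo ≤ s → s ≤ a → R a ≤ R s)
  where

  M : ℚ → ℚ
  M s = L s ⊔ R s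

  IsMinimiser : ℚ → Set
  IsMinimiser x = (lo ≤ x × x ≤ hi) × (∀ s → lo ≤ s × s ≤ hi → M x ≤ M s)

  private
    0≤b-a : 0ℚ ≤ b - a
    0≤b-a = p≤q⇒0≤q-p (ℚP.<⇒≤ a<b)

    ≤M-left : ∀ {v s} → v ≤ L s → v ≤ M s
    ≤M-left {s = s} v≤L = ℚP.≤-trans v≤L (ℚP.p≤p⊔q (L s) (R s))

    ≤M-right : ∀ {v s} → v ≤ R s → v ≤ M s
    ≤M-right {s = s} v≤R = ℚP.≤-trans v≤R (ℚP.p≤q⊔p (L s) (R s))

  M-lower-bound : ∀ {v} → v ≤ R a → v ≤ L b → (∀ {s} → a < s → s < b → v ≤ M s) →
                  ∀ {s} → lo ≤ s → s ≤ hi → v ≤ M s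
  M-lower-bound {v} v≤Ra v≤Lb inside {s} lo≤s s≤hi with s ℚP.≤? a
  ... | yes s≤a = ≤M-right (ℚP.≤-trans v≤Ra (R-antimono lo≤s s≤a))
  ... | no s≰a with b ℚP.≤? s
  ...   | yes b≤s = ≤M-left (ℚP.≤-trans v≤Lb (L-mono b≤s s≤hi))
  ...   | no b≰s = inside (ℚP.≰⇒> s≰a) (ℚP.≰⇒> b≰s)

  minimiser-left : L a < R a → R a ≤ L b - (b - a) → IsMinimiser a
  minimiser-left La<Ra Ra≤Lb-d =
      (lo≤a , ℚP.≤-trans (ℚP.<⇒≤ a<b) b≤hi)
    , λ s (lo≤s , s≤hi) → subst (_≤ M s) (sym (ℚP.p≤q⇒p⊔q≡q (ℚP.<⇒≤ La<Ra)))
        (M-lower-bound ℚP.≤-refl (ℚP.≤-trans Ra≤Lb-d (p-q≤p 0≤b-a)) inside lo≤s s≤hi)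
    where
    inside : ∀ {s} → a < s → s < b → R a ≤ M s
    inside {s} a<s s<b = ≤M-left (begin
      R a                   ≤⟨ Ra≤Lb-d ⟩
      L b - (b - a)         ≡⟨ cong (_- (b - a)) (L-slope a<s (ℚP.<⇒≤ s<b)) ⟩
      L s + (b - s) - (b - a) ≡⟨ solve 4 (λ l a b s → l :+ (b :- s) :- (b :- a) := l :- (s :- a)) refl (L s) a b s ⟩
      L s - (s - a)         ≤⟨ p-q≤p (p≤q⇒0≤q-p (ℚP.<⇒≤ a<s)) ⟩
      L s                   ∎)
      where open ℚP.≤-Reasoning

  minimiser-right : R b ≤ L b → L b ≤ R a - (b - a) → IsMinimiser b
  minimiser-right Rb≤Lb Lb≤Ra-d =
      (ℚP.≤-trans lo≤a (ℚP.<⇒≤ a<b) , b≤hi)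
    , λ s (lo≤s , s≤hi) → subst (_≤ M s) (sym (ℚP.p≥q⇒p⊔q≡p Rb≤Lb))
        (M-lower-bound (ℚP.≤-trans Lb≤Ra-d (p-q≤p 0≤b-a)) ℚP.≤-refl inside lo≤s s≤hi)
    where
    inside : ∀ {s} → a < s → s < b → L b ≤ M s
    inside {s} a<s s<b = ≤M-right (begin
      L b                     ≤⟨ Lb≤Ra-d ⟩
      R a - (b - a)           ≡⟨ cong (_- (b - a)) (R-slope (ℚP.<⇒≤ a<s) s<b) ⟩
      R s + (s - a) - (b - a) ≡⟨ solve 4 (λ r a b s → r :+ (s :- a) :- (b :- a) := r :- (b :- s)) refl (R s) a b s ⟩
      R s - (b - s)           ≤⟨ p-q≤p (p≤q⇒0≤q-p (ℚP.<⇒≤ s<b)) ⟩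
      R s                     ∎)
      where open ℚP.≤-Reasoning

  -- On (a, b) the two slope-one pieces always sum to R a + L b - (b - a) = 2v,
  -- so their maximum is at least v, with equality where they cross.
  minimiser-crossing : L b - (b - a) < R a → R a - (b - a) < L b →
                       IsMinimiser (½ * (R a - L b + (a + b)))
  minimiser-crossing Lb-d<Ra Ra-d<Lb =
      (ℚP.≤-trans lo≤a (ℚP.<⇒≤ a<x) , ℚP.≤-trans (ℚP.<⇒≤ x<b) b≤hi)
    , λ s (lo≤s , s≤hi) → subst (_≤ M s) (sym Mx≡v) (M-lower-bound v≤Ra v≤Lb inside lo≤s s≤hi)
    where
    x v δ₁ δ₂ : ℚ
    x = ½ * (R a - L b + (a + b))
    v = ½ * (R a + L b - (b - a))
    δ₁ = ½ * (R a - (L b - (b - a)))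
    δ₂ = ½ * (L b - (R a - (b - a)))

    0<δ₁ : 0ℚ < δ₁
    0<δ₁ = ℚP.*-monoʳ-<-pos ½ (p<q⇒0<q-p Lb-d<Ra)
    0<δ₂ : 0ℚ < δ₂
    0<δ₂ = ℚP.*-monoʳ-<-pos ½ (p<q⇒0<q-p Ra-d<Lb)

    a<x : a < x
    a<x = subst (a <_) a+δ₁≡x (p<p+q 0<δ₁)
      where
      a+δ₁≡x : a + δ₁ ≡ x
      a+δ₁≡x = solve 4 (λ r l a b → a :+ con ½ :* (r :- (l :- (b :- a))) := con ½ :* (r :- l :+ (a :+ b)))
                 refl (R a) (L b) a b
    x<b : x < b
    x<b = subst (x <_) x+δ₂≡b (p<p+q 0<δ₂)
      where
      x+δ₂≡b : x + δ₂ ≡ b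
      x+δ₂≡b = solve 4 (λ r l a b → con ½ :* (r :- l :+ (a :+ b)) :+ con ½ :* (l :- (r :- (b :- a))) := b)
                 refl (R a) (L b) a b
    v≤Ra : v ≤ R a
    v≤Ra = subst (_≤ R a) Ra-δ₁≡v (p-q≤p (ℚP.<⇒≤ 0<δ₁))
      where
      Ra-δ₁≡v : R a - δ₁ ≡ v
      Ra-δ₁≡v = solve 4 (λ r l a b → r :- con ½ :* (r :- (l :- (b :- a))) := con ½ :* (r :+ l :- (b :- a)))
                  refl (R a) (L b) a b
    v≤Lb : v ≤ L b
    v≤Lb = subst (_≤ L b) Lb-δ₂≡v (p-q≤p (ℚP.<⇒≤ 0<δ₂))
      where
      Lb-δ₂≡v : L b - δ₂ ≡ v
      Lb-δ₂≡v = solve 4 (λ r l a b → l :- con ½ :* (l :- (r :- (b :- a))) := con ½ :* (r :+ l :- (b :- a)))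
                  refl (R a) (L b) a b

    Lx≡v : L x ≡ v
    Lx≡v = begin
      L x                     ≡⟨ solve 2 (λ l d → l := l :+ d :- d) refl (L x) (b - x) ⟩
      L x + (b - x) - (b - x) ≡⟨ cong (_- (b - x)) (sym (L-slope a<x (ℚP.<⇒≤ x<b))) ⟩
      L b - (b - x)           ≡⟨ solve 4 (λ r l a b → l :- (b :- con ½ :* (r :- l :+ (a :+ b)))
                                                      := con ½ :* (r :+ l :- (b :- a))) refl (R a) (L b) a b ⟩
      v                       ∎
      where open ≡-Reasoning
    Rx≡v : R x ≡ v
    Rx≡v = begin
      R x                     ≡⟨ solve 2 (λ r d → r := r :+ d :- d) refl (R x) (x - a) ⟩
      R x + (x - a) - (x - a) ≡⟨ cong (_- (x - a)) (sym (R-slope (ℚP.<⇒≤ a<x) x<b)) ⟩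
      R a - (x - a)           ≡⟨ solve 4 (λ r l a b → r :- (con ½ :* (r :- l :+ (a :+ b)) :- a)
                                                      := con ½ :* (r :+ l :- (b :- a))) refl (R a) (L b) a b ⟩
      v                       ∎
      where open ≡-Reasoning
    Mx≡v : M x ≡ v
    Mx≡v = trans (cong₂ _⊔_ Lx≡v Rx≡v) (ℚP.⊔-idem v)

    inside : ∀ {s} → a < s → s < b → v ≤ M s
    inside {s} a<s s<b = begin
      v
        ≡⟨ cong₂ (λ r l → ½ * (r + l - (b - a))) (R-slope (ℚP.<⇒≤ a<s) s<b) (L-slope a<s (ℚP.<⇒≤ s<b)) ⟩
      ½ * (R s + (s - a) + (L s + (b - s)) - (b - a))
        ≡⟨ solve 5 (λ r l a b s → con ½ :* (r :+ (s :- a) :+ (l :+ (b :- s)) :- (b :- a)) := con ½ :* (l :+ r))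
             refl (R s) (L s) a b s ⟩
      ½ * (L s + R s)
        ≤⟨ ½[p+q]≤p⊔q (L s) (R s) ⟩
      M s ∎
      where open ℚP.≤-Reasoning

Any⇒≡just : ∀ {P : ℕ → Set} {mx : Maybe ℕ} → Any P mx → mx ≡ just (fromMaybe 0 mx)
Any⇒≡just (just _) = refl

Any⇒fromMaybe : ∀ {P : ℕ → Set} {mx : Maybe ℕ} → Any P mx → P (fromMaybe 0 mx)
Any⇒fromMaybe (just p) = p

lastNZ-∷ : ∀ {m} x xs → Any (m ℕ.≤_) (lastNZ xs) → Any (suc m ℕ.≤_) (lastNZ (x ∷ xs))
lastNZ-∷ x xs h with lastNZ xs
lastNZ-∷ x xs (just m≤i) | just i = just (s≤s m≤i)

lastNZ-∷-nonzero : ∀ {x} xs → x ≢ 0 → Any (0 ℕ.≤_) (lastNZ (x ∷ xs))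
lastNZ-∷-nonzero {x} xs x≢0 with lastNZ xs
... | just i = just z≤n
... | nothing with x ℕP.≟ 0
...   | yes x≡0 = ⊥-elim (x≢0 x≡0)
...   | no _ = just z≤n

lastNZ-replicate : ∀ {m} d xs → Any (m ℕ.≤_) (lastNZ xs) → Any (d ℕ.+ m ℕ.≤_) (lastNZ (replicate d 0 ++ xs))
lastNZ-replicate zero xs h = h
lastNZ-replicate (suc d) xs h = lastNZ-∷ 0 (replicate d 0 ++ xs) (lastNZ-replicate d xs h)

lastNZ-addHead : ∀ {P : ℕ → Set} x xs → Any P (lastNZ xs) → Any P (lastNZ (addHead x xs))
lastNZ-addHead x (y ∷ ys) h with lastNZ ys
... | just i = h
... | nothing with y ℕP.≟ 0 | h
...   | no y≢0 | h′ with x ℕ.+ y ℕP.≟ 0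
...     | yes x+y≡0 = ⊥-elim (y≢0 (ℕP.m+n≡0⇒n≡0 x x+y≡0))
...     | no _ = h′

lastNZ-process : ∀ {k m} q as → 1 ℕ.≤ k → Any (m ℕ.≤_) (lastNZ as) → Any (m ℕ.≤_) (lastNZ (process k q as))
lastNZ-process {k} q (a ∷ as) 1≤k h with lastNZ as in eq
... | just i = Any.map (λ suc-i≤j → ℕP.≤-trans (Any.drop-just h) suc-i≤j)
                 (lastNZ-∷ out (process k rest as)
                   (lastNZ-process rest as 1≤k (subst (Any (i ℕ.≤_)) (sym eq) (just ℕP.≤-refl))))
  where
  out rest : ℕ
  out = (q ℕ.+ a) ⊓ k
  rest = q ℕ.+ a ∸ out
... | nothing with a ℕP.≟ 0 | h
...   | no a≢0 | just m≤0 = Any.map (λ _ → ℕP.≤-trans m≤0 z≤n) (lastNZ-∷-nonzero (process k rest as) out≢0)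
  where
  out rest : ℕ
  out = (q ℕ.+ a) ⊓ k
  rest = q ℕ.+ a ∸ out
  out≢0 : out ≢ 0
  out≢0 = ℕP.n>0⇒n≢0 (ℕP.⊓-glb (ℕP.≤-trans (ℕP.n≢0⇒n>0 a≢0) (ℕP.m≤n+m a q)) 1≤k)

module _ (P : DynPath) where

  lastBelow-just : ∀ {s k} j → k ℕ.≤ j → X P k < s → (∀ {i} → k ℕ.< i → i ℕ.≤ j → s ≤ X P i) →
                   lastBelow P s j ≡ just k
  lastBelow-just {s} zero z≤n Xk<s _ with X P 0 ℚP.<? s
  ... | yes _ = refl
  ... | no X0≮s = ⊥-elim (X0≮s Xk<s)
  lastBelow-just {s} {k} (suc j) k≤j+1 Xk<s s≤X with X P (suc j) ℚP.<? s | ℕP.m≤n⇒m<n∨m≡n k≤j+1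
  ... | yes _ | inj₂ refl = refl
  ... | yes Xj+1<s | inj₁ k<j+1 = ⊥-elim (<⇒≱ Xj+1<s (s≤X k<j+1 ℕP.≤-refl))
  ... | no Xj+1≮s | inj₂ refl = ⊥-elim (Xj+1≮s Xk<s)
  ... | no _ | inj₁ (s≤s k≤j) = lastBelow-just j k≤j Xk<s (λ k<i i≤j → s≤X k<i (ℕP.m≤n⇒m≤1+n i≤j))

  lastBelow-nothing : ∀ {s} j → (∀ {i} → i ℕ.≤ j → s ≤ X P i) → lastBelow P s j ≡ nothing
  lastBelow-nothing {s} zero s≤X with X P 0 ℚP.<? s
  ... | yes X0<s = ⊥-elim (<⇒≱ X0<s (s≤X z≤n))
  ... | no _ = refl
  lastBelow-nothing {s} (suc j) s≤X with X P (suc j) ℚP.<? s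
  ... | yes Xj+1<s = ⊥-elim (<⇒≱ Xj+1<s (s≤X ℕP.≤-refl))
  ... | no _ = lastBelow-nothing j (λ i≤j → s≤X (ℕP.m≤n⇒m≤1+n i≤j))

  lastBelow-sound : ∀ {s k} j → lastBelow P s j ≡ just k → X P k < s
  lastBelow-sound {s} zero eq with X P 0 ℚP.<? s
  lastBelow-sound zero refl | yes X0<s = X0<s
  lastBelow-sound {s} (suc j) eq with X P (suc j) ℚP.<? s
  lastBelow-sound (suc j) refl | yes Xj+1<s = Xj+1<s
  ... | no _ = lastBelow-sound j eq

  ΘL-nonneg : ∀ s → 0ℚ ≤ ΘL P s
  ΘL-nonneg s with lastBelow P s (n P) in eq
  ... | nothing = ℚP.≤-refl
  ... | just k with lastNZ (departures P k)
  ...   | nothing = ℚP.≤-refl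
  ...   | just T = ℚP.≤-trans (0≤ℕtoℚ T) (p≤p+q (p≤q⇒0≤q-p (ℚP.<⇒≤ (lastBelow-sound (n P) eq))))

module _ {P : DynPath} (V : Valid P) where

  pos-mono : ∀ {i j} → i ℕ.≤ j → j ℕ.≤ n P → pos P i ℕ.≤ pos P j
  pos-mono {j = zero} z≤n _ = ℕP.≤-refl
  pos-mono {i} {suc j} i≤j j<n with ℕP.m≤n⇒m<n∨m≡n i≤j
  ... | inj₂ refl = ℕP.≤-refl
  ... | inj₁ (s≤s i≤j) = ℕP.≤-trans (pos-mono i≤j (ℕP.<⇒≤ j<n)) (ℕP.<⇒≤ (incr V j j<n))

  X-mono : ∀ {i j} → i ℕ.≤ j → j ℕ.≤ n P → X P i ≤ X P j
  X-mono i≤j j≤n = ℕtoℚ-mono-≤ (pos-mono i≤j j≤n)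

  X-step : ∀ {i} → suc i ℕ.≤ n P → X P i < X P (suc i)
  X-step {i} i<n = ℕtoℚ-mono-< (incr V i i<n)

  ΘL-below : ∀ {s} → s ≤ X P 0 → ΘL P s ≡ 0ℚ
  ΘL-below s≤X0 rewrite lastBelow-nothing P (n P) (λ i≤n → ℚP.≤-trans s≤X0 (X-mono z≤n i≤n)) = refl

  reversePath-valid : Valid (reversePath P)
  reversePath-valid = record { incr = reverse-incr ; cap = reverse-cap }
    where
    reverse-incr : ∀ i → suc i ℕ.≤ n P → pos P (n P) ∸ pos P (n P ∸ i) ℕ.< pos P (n P) ∸ pos P (n P ∸ suc i)
    reverse-incr i i<n rewrite ℕP.+-∸-assoc 1 i<n =
      ℕP.∸-monoʳ-< (incr V (n P ∸ suc i) k<n) (pos-mono k<n ℕP.≤-refl)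
      where
      k<n : suc (n P ∸ suc i) ℕ.≤ n P
      k<n = subst (ℕ._≤ n P) (ℕP.+-∸-assoc 1 i<n) (ℕP.m∸n≤m (n P) i)
    reverse-cap : ∀ i → 1 ℕ.≤ i → i ℕ.≤ n P → 1 ℕ.≤ c P (suc (n P) ∸ i)
    reverse-cap i 1≤i i≤n rewrite ℕP.+-∸-assoc 1 i≤n =
      cap V (suc (n P ∸ i)) (s≤s z≤n) (ℕP.∸-monoʳ-< {n P} {i} {0} 1≤i i≤n)

lastDeparture : DynPath → ℕ → ℕ
lastDeparture P k = fromMaybe 0 (lastNZ (departures P k))

module _ {P : DynPath} (V : Valid P) (w₀ : 1 ℕ.≤ w P 0) where

  private
    departures₀ : 0 ℕ.< n P → Any (0 ℕ.≤_) (lastNZ (departures P 0))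
    departures₀ 0<n = lastNZ-process 0 (arrivals P 0) (cap V 1 ℕP.≤-refl 0<n) (lastNZ-∷-nonzero [] (ℕP.n>0⇒n≢0 w₀))

    departures-suc : ∀ {j T} → suc j ℕ.< n P → lastNZ (departures P j) ≡ just T →
                     Any ((pos P (suc j) ∸ pos P j) ℕ.+ T ℕ.≤_) (lastNZ (departures P (suc j)))
    departures-suc {j} {T} j+1<n lastNZ≡T =
      lastNZ-process 0 (arrivals P (suc j)) (cap V (suc (suc j)) (s≤s z≤n) j+1<n)
        (lastNZ-addHead (w P (suc j)) (replicate (pos P (suc j) ∸ pos P j) 0 ++ departures P j)
          (lastNZ-replicate (pos P (suc j) ∸ pos P j) (departures P j)
            (subst (Any (T ℕ.≤_)) (sym lastNZ≡T) (just ℕP.≤-refl))))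

  lastDeparture-spec : ∀ k → k ℕ.< n P → lastNZ (departures P k) ≡ just (lastDeparture P k)
  lastDeparture-spec zero 0<n = Any⇒≡just (departures₀ 0<n)
  lastDeparture-spec (suc j) j+1<n =
    Any⇒≡just (departures-suc j+1<n (lastDeparture-spec j (ℕP.<-trans (ℕP.n<1+n j) j+1<n)))

  lastDeparture-step : ∀ j → suc j ℕ.< n P →
                       (pos P (suc j) ∸ pos P j) ℕ.+ lastDeparture P j ℕ.≤ lastDeparture P (suc j)
  lastDeparture-step j j+1<n =
    Any⇒fromMaybe (departures-suc j+1<n (lastDeparture-spec j (ℕP.<-trans (ℕP.n<1+n j) j+1<n)))

  lastDeparture-mono : ∀ {j k} → j ℕ.≤ k → k ℕ.< n P → lastDeparture P j ℕ.≤ lastDeparture P k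
  lastDeparture-mono {k = zero} z≤n _ = ℕP.≤-refl
  lastDeparture-mono {j} {suc k} j≤k k<n with ℕP.m≤n⇒m<n∨m≡n j≤k
  ... | inj₂ refl = ℕP.≤-refl
  ... | inj₁ (s≤s j≤k) = ℕP.≤-trans (lastDeparture-mono j≤k (ℕP.<-trans (ℕP.n<1+n k) k<n))
                           (ℕP.≤-trans (ℕP.m≤n+m _ _) (lastDeparture-step k k<n))

  ΘL-segment : ∀ {k s} → k ℕ.< n P → X P k < s → s ≤ X P (suc k) →
               ΘL P s ≡ ℕtoℚ (lastDeparture P k) + (s - X P k)
  ΘL-segment {k} k<n Xk<s s≤Xk+1
    rewrite lastBelow-just P (n P) (ℕP.<⇒≤ k<n) Xk<s (λ k<i i≤n → ℚP.≤-trans s≤Xk+1 (X-mono V k<i i≤n))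
          | lastDeparture-spec k k<n = refl

  ΘL-slope : ∀ {k s s′} → k ℕ.< n P → X P k < s → s ≤ s′ → s′ ≤ X P (suc k) →
             ΘL P s′ ≡ ΘL P s + (s′ - s)
  ΘL-slope {k} {s} {s′} k<n Xk<s s≤s′ s′≤Xk+1 = begin
    ΘL P s′                    ≡⟨ ΘL-segment k<n (ℚP.<-≤-trans Xk<s s≤s′) s′≤Xk+1 ⟩
    T + (s′ - X P k)
      ≡⟨ solve 4 (λ t x s s′ → t :+ (s′ :- x) := t :+ (s :- x) :+ (s′ :- s)) refl T (X P k) s s′ ⟩
    T + (s - X P k) + (s′ - s) ≡⟨ cong (_+ (s′ - s)) (sym (ΘL-segment k<n Xk<s (ℚP.≤-trans s≤s′ s′≤Xk+1))) ⟩
    ΘL P s + (s′ - s)          ∎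
    where
    open ≡-Reasoning
    T : ℚ
    T = ℕtoℚ (lastDeparture P k)

  ΘL-vertex≤lastDeparture : ∀ {j m} → j ℕ.≤ m → m ℕ.< n P → ΘL P (X P j) ≤ ℕtoℚ (lastDeparture P m)
  ΘL-vertex≤lastDeparture {zero} {m} _ _ =
    subst (_≤ ℕtoℚ (lastDeparture P m)) (sym (ΘL-below V ℚP.≤-refl)) (0≤ℕtoℚ (lastDeparture P m))
  ΘL-vertex≤lastDeparture {suc j} {m} j<m m<n = begin
    ΘL P (X P (suc j))                      ≡⟨ ΘL-segment j<n (X-step V j+1≤n) ℚP.≤-refl ⟩
    ℕtoℚ (lastDeparture P j) + (X P (suc j) - X P j)
      ≡⟨ cong (λ x → ℕtoℚ (lastDeparture P j) + x) (sym (ℕtoℚ-∸ (pos-mono V (ℕP.n≤1+n j) j+1≤n))) ⟩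
    ℕtoℚ (lastDeparture P j) + ℕtoℚ d       ≡⟨ ℚP.+-comm (ℕtoℚ (lastDeparture P j)) (ℕtoℚ d) ⟩
    ℕtoℚ d + ℕtoℚ (lastDeparture P j)       ≡⟨ sym (ℕtoℚ-+ d (lastDeparture P j)) ⟩
    ℕtoℚ (d ℕ.+ lastDeparture P j)
      ≤⟨ ℕtoℚ-mono-≤ (ℕP.≤-trans (lastDeparture-step j j+1<n) (lastDeparture-mono j<m m<n)) ⟩
    ℕtoℚ (lastDeparture P m)                ∎
    where
    open ℚP.≤-Reasoning
    d : ℕ
    d = pos P (suc j) ∸ pos P j
    j+1<n : suc j ℕ.< n P
    j+1<n = ℕP.≤-<-trans j<m m<n
    j+1≤n : suc j ℕ.≤ n P
    j+1≤n = ℕP.<⇒≤ j+1<n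
    j<n : j ℕ.< n P
    j<n = ℕP.<-trans (ℕP.n<1+n j) j+1<n

  ΘL-vertex-≤ : ∀ {j m s} → j ℕ.≤ m → m ℕ.≤ n P → X P j ≤ s → s ≤ X P m → ΘL P (X P j) ≤ ΘL P s
  ΘL-vertex-≤ {m = zero} z≤n _ X0≤s s≤X0 = ℚP.≤-reflexive (cong (ΘL P) (ℚP.≤-antisym X0≤s s≤X0))
  ΘL-vertex-≤ {j} {suc m} {s} j≤m+1 m<n Xj≤s s≤Xm+1 with ℕP.m≤n⇒m<n∨m≡n j≤m+1
  ... | inj₂ refl = ℚP.≤-reflexive (cong (ΘL P) (ℚP.≤-antisym Xj≤s s≤Xm+1))
  ... | inj₁ (s≤s j≤m) with s ℚP.≤? X P m
  ...   | yes s≤Xm = ΘL-vertex-≤ j≤m (ℕP.<⇒≤ m<n) Xj≤s s≤Xm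
  ...   | no s≰Xm = begin
    ΘL P (X P j)                          ≤⟨ ΘL-vertex≤lastDeparture j≤m m<n ⟩
    ℕtoℚ (lastDeparture P m)              ≤⟨ p≤p+q (p≤q⇒0≤q-p (ℚP.<⇒≤ Xm<s)) ⟩
    ℕtoℚ (lastDeparture P m) + (s - X P m) ≡⟨ sym (ΘL-segment m<n Xm<s s≤Xm+1) ⟩
    ΘL P s                                ∎
    where
    open ℚP.≤-Reasoning
    Xm<s : X P m < s
    Xm<s = ℚP.≰⇒> s≰Xm

module _ {P : DynPath} (V : Valid P) where

  private
    P′ : DynPath
    P′ = reversePath P
    V′ : Valid P′
    V′ = reversePath-valid V
    N : ℚ
    N = X P (n P)

  X-reverse : ∀ {i j} → j ℕ.≤ n P → n P ∸ j ≡ i → X P′ i ≡ N - X P j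
  X-reverse {i} {j} j≤n refl = begin
    X P′ (n P ∸ j)              ≡⟨ ℕtoℚ-∸ (pos-mono V (ℕP.m∸n≤m (n P) (n P ∸ j)) ℕP.≤-refl) ⟩
    N - X P (n P ∸ (n P ∸ j))   ≡⟨ cong (λ k → N - X P k) (ℕP.m∸[m∸n]≡n j≤n) ⟩
    N - X P j                   ∎
    where open ≡-Reasoning

  ΘR-last : ΘR P N ≡ 0ℚ
  ΘR-last = trans (cong (ΘL P′) (ℚP.+-inverseʳ N)) (ΘL-below V′ (0≤ℕtoℚ (pos P′ 0)))

  module _ (wₙ : 1 ℕ.≤ w P (n P)) where

    ΘR-slope : ∀ {k s s′} → k ℕ.< n P → X P k ≤ s → s ≤ s′ → s′ < X P (suc k) →
               ΘR P s ≡ ΘR P s′ + (s′ - s)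
    ΘR-slope {k} {s} {s′} k<n Xk≤s s≤s′ s′<Xk+1 = begin
      ΘL P′ (N - s)                          ≡⟨ ΘL-slope V′ wₙ k′<n Xk′<N-s′ (r-q≤r-p N s≤s′) N-s≤Xk′+1 ⟩
      ΘL P′ (N - s′) + ((N - s) - (N - s′))
        ≡⟨ cong (λ x → ΘL P′ (N - s′) + x) (solve 3 (λ N s s′ → (N :- s) :- (N :- s′) := s′ :- s) refl N s s′) ⟩
      ΘL P′ (N - s′) + (s′ - s)              ∎
      where
      open ≡-Reasoning
      k′ : ℕ
      k′ = n P ∸ suc k
      k′<n : k′ ℕ.< n P
      k′<n = ℕP.∸-monoʳ-< {n P} {suc k} {0} (s≤s z≤n) k<n
      Xk′<N-s′ : X P′ k′ < N - s′
      Xk′<N-s′ = subst (_< N - s′) (sym (X-reverse k<n refl)) (r-q<r-p N s′<Xk+1)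
      N-s≤Xk′+1 : N - s ≤ X P′ (suc k′)
      N-s≤Xk′+1 = subst (N - s ≤_) (sym (X-reverse (ℕP.<⇒≤ k<n) (ℕP.+-∸-assoc 1 k<n))) (r-q≤r-p N Xk≤s)

    ΘR-vertex-≤ : ∀ {t s} → t ℕ.≤ n P → X P 0 ≤ s → s ≤ X P t → ΘR P (X P t) ≤ ΘR P s
    ΘR-vertex-≤ {t} {s} t≤n X0≤s s≤Xt =
      subst (λ x → ΘL P′ x ≤ ΘL P′ (N - s)) (X-reverse t≤n refl)
        (ΘL-vertex-≤ V′ wₙ (ℕP.m∸n≤m (n P) t) ℕP.≤-refl
          (subst (_≤ N - s) (sym (X-reverse t≤n refl)) (r-q≤r-p N s≤Xt))
          (subst (N - s ≤_) (sym (X-reverse z≤n refl)) (r-q≤r-p N X0≤s)))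

lemma3 : (P : DynPath) → Valid P → 1 ℕ.≤ n P → 1 ℕ.≤ w P 0 → 1 ℕ.≤ w P (n P) →
         (t : ℕ) → t ℕ.≤ n P → ΘL P (X P t) < ΘR P (X P t) →
         (∀ i → t ℕ.< i → i ℕ.≤ n P → ¬ (ΘL P (X P i) < ΘR P (X P i))) →
         let d     = X P (suc t) - X P t
             ΘL⁺xt = ΘL P (X P (suc t)) - d
             ΘR⁻xt1 = ΘR P (X P t) - d
         in (ΘR P (X P t) ≤ ΘL⁺xt → IsOptimalSink P (X P t))
            × (ΘL⁺xt < ΘR P (X P t) → ΘR⁻xt1 < ΘL P (X P (suc t)) →
                 IsOptimalSink P (½ * (ΘR P (X P t) - ΘL P (X P (suc t)) + (X P t + X P (suc t)))))
            × (ΘL P (X P (suc t)) ≤ ΘR⁻xt1 → IsOptimalSink P (X P (suc t)))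
lemma3 P V _ w₀ wₙ t t≤n Lt<Rt later-L≥R = minimiser-left Lt<Rt , minimiser-crossing , minimiser-right Rt+1≤Lt+1
  where
  t<n : t ℕ.< n P
  t<n with ℕP.m≤n⇒m<n∨m≡n t≤n
  ... | inj₁ t<n = t<n
  ... | inj₂ refl = ⊥-elim (<⇒≱ Lt<Rt (subst (_≤ ΘL P (X P t)) (sym (ΘR-last V)) (ΘL-nonneg P (X P t))))

  open Envelope (ΘL P) (ΘR P) (X-mono V z≤n t≤n) (X-step V t<n) (X-mono V t<n ℕP.≤-refl)
    (λ a<s s≤b → ΘL-slope V w₀ t<n a<s s≤b ℚP.≤-refl) (ΘL-vertex-≤ V w₀ t<n ℕP.≤-refl)
    (λ a≤s s<b → ΘR-slope V wₙ t<n ℚP.≤-refl a≤s s<b) (ΘR-vertex-≤ V wₙ t≤n)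

  Rt+1≤Lt+1 : ΘR P (X P (suc t)) ≤ ΘL P (X P (suc t))
  Rt+1≤Lt+1 = ℚP.≮⇒≥ (later-L≥R (suc t) (ℕP.n<1+n t) t<n)
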